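{- Let $K$ be an algebraically closed field of characteristic $0$, $n\ge1$, $d\ge2$, $1\le r\le n$, and $P=[\alpha_0,\ldots,\alpha_n]\in\mathbb{P}^n(K)$ with all $\alpha_i\ne0$ and $\mathcal{R}(P)=\{\mathbf{0}\}$. For each $p\in\mathcal{P}_{r,n}$ fix a partition $\mathcal{I}_p$ of $\mathcal{S}_{r+1}$, and let $\mathbf{F}$ be the associated map defined below. If for some $p\in\mathcal{P}_{r,n}$ the partition $\mathcal{I}_p$ is not exceptional, then $\mathbf{F}$ is injective. More precisely, if $\mathbf{m},\widetilde{\mathbf{m}}\in\mathcal{M}_P$ satisfy $\mathbf{F}(\mathbf{m})=\mathbf{F}(\widetilde{\mathbf{m}})$ and $m_t\ne\widetilde m_t$ for some index $t$, then for every $p\in\mathcal{P}_{r,n}$ the partition $\mathcal{I}_p$ is a subpartition of $\mathcal{I}^t_\bullet$.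
   Context: $\mathcal{R}(P)=\{(e_0,\ldots,e_n)\in\mathbb{Z}^{n+1}:\sum_ie_i=0,\ \prod_i\alpha_i^{e_i}=1\}$. $\mathcal{S}_{r+1}$ is the symmetric group on $\{0,\ldots,r\}$; $\mathcal{P}_{r,n}$ is the set of strictly increasing maps $\{0,\ldots,r\}\to\{0,\ldots,n\}$. For $\mathbf{m}=(m_0,\ldots,m_r)$, $k_i(\mathbf{m})=d^{m_i}$ and $u_{\sigma,p}(\mathbf{m})=\prod_{i=0}^r\alpha_{p(i)}^{k_{\sigma(i)}(\mathbf{m})}$. $A_{\mathbf{m}}=(\alpha_j^{d^{m_i}})_{0\le i\le r,0\le j\le n}$; a matrix has super-rank $r$ if it has rank $r$ and every submatrix of $r$ of its rows has rank $r$; $\mathcal{M}_P=\{\mathbf{m}\in\mathbb{Z}^{r+1}:0\le m_0<\cdots<m_r,\ A_{\mathbf{m}}\text{ has super-rank } r\}$. $\mathbf{F}:\mathcal{M}_P\to\prod_{p}\prod_{T\in\mathcal{I}_p}\mathbb{P}^{\#T-1}(K)$ is $\mathbf{m}\mapsto([u_{\sigma,p}(\mathbf{m})]_{\sigma\in T})_{p,T}$. For $0\le t,j\le r$ let $T^t_j=\{\sigma\in\mathcal{S}_{r+1}:\sigma(j)=t\}$ and $\mathcal{I}^t_\bullet=\{T^t_0,\ldots,T^t_r\}$ (a partition of $\mathcal{S}_{r+1}$). A partition of $\mathcal{S}_{r+1}$ is exceptional if it is a subpartition of $\mathcal{I}^t_\bullet$ for some $0\le t\le r$ (i.e. every block lies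 in some block of $\mathcal{I}^t_\bullet$). -}

module Defs where

open import Level using (Level; _⊔_; 0ℓ)
open import Data.Nat as ℕ using (ℕ; zero; suc; _^_)
open import Data.Integer as ℤ using (ℤ; +_; -[1+_])
open import Data.Fin as Fin using (Fin; zero; suc)
open import Data.Fin.Permutation using (Permutation′; _⟨$⟩ʳ_)
open import Data.Product using (Σ; ∃; _×_; _,_)
open import Relation.Binary.PropositionalEquality using (_≡_)
open import Relation.Binary.Core using (Rel)
open import Relation.Binary.Structures using (IsEquivalence)
open import Relation.Nullary using (¬_)
open import Function.Definitions using (Injective)
open import Algebra.Bundles using (CommutativeRing)

module _ {c ℓ : Level} (R : CommutativeRing c ℓ) where
  open CommutativeRing R using (Carrier; _+_; _*_; 0#; 1#)

  pow : Carrier → ℕ → Carrier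
  pow x zero    = 1#
  pow x (suc n) = x * pow x n

  natMul : ℕ → Carrier
  natMul zero    = 0#
  natMul (suc n) = 1# + natMul n

  sumF : ∀ {k} → (Fin k → Carrier) → Carrier
  sumF {zero}  f = 0#
  sumF {suc k} f = f zero + sumF (λ i → f (suc i))

  prodF : ∀ {k} → (Fin k → Carrier) → Carrier
  prodF {zero}  f = 1#
  prodF {suc k} f = f zero * prodF (λ i → f (suc i))

record ACField0 (c ℓ : Level) : Set (Level.suc (c ⊔ ℓ)) where
  field
    ring : CommutativeRing c ℓ
  open CommutativeRing ring public using (Carrier; _≈_; _+_; _*_; 0#; 1#)
  field
    -- multiplicative inverse (the value at 0 is irrelevant)
    _⁻¹      : Carrier → Carrier
    inverse  : ∀ x → ¬ (x ≈ 0#) → x * (x ⁻¹) ≈ 1#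
    0≉1      : ¬ (0# ≈ 1#)
    char0    : ∀ n → ¬ (natMul ring (suc n) ≈ 0#)
    closed   : ∀ k (cs : Fin (suc k) → Carrier) →
               ∃ λ x → (pow ring x (suc k) + sumF ring (λ i → cs i * pow ring x (Fin.toℕ i))) ≈ 0#

module _ {c ℓ : Level} (K : ACField0 c ℓ) where
  open ACField0 K

  zpow : Carrier → ℤ → Carrier
  zpow x (+ n)    = pow ring x n
  zpow x -[1+ n ] = pow ring (x ⁻¹) (suc n)

  sumℤ : ∀ {k} → (Fin k → ℤ) → ℤ
  sumℤ {zero}  e = + 0
  sumℤ {suc k} e = e zero ℤ.+ sumℤ (λ i → e (suc i))

  TrivialRelations : ∀ {n} → (Fin (suc n) → Carrier) → Set ℓ
  TrivialRelations α =
    ∀ (e : Fin _ → ℤ) → sumℤ e ≡ + 0 →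
      prodF ring (λ i → zpow (α i) (e i)) ≈ 1# → ∀ i → e i ≡ + 0

  LinIndep : ∀ {k b} → (Fin k → Fin b → Carrier) → Set (c ⊔ ℓ)
  LinIndep v =
    ∀ (cs : Fin _ → Carrier) → (∀ j → sumF ring (λ i → cs i * v i j) ≈ 0#) →
      ∀ i → cs i ≈ 0#

  HasRank : ∀ {a b} → (Fin a → Fin b → Carrier) → ℕ → Set (c ⊔ ℓ)
  HasRank {a} A k =
    (∃ λ (s : Fin k → Fin a) → Injective _≡_ _≡_ s × LinIndep (λ i → A (s i)))
    × (∀ (s : Fin (suc k) → Fin a) → Injective _≡_ _≡_ s → ¬ LinIndep (λ i → A (s i)))

  SuperRank : ∀ {r b} → (Fin (suc r) → Fin b → Carrier) → Set (c ⊔ ℓ)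
  SuperRank {r} A =
    HasRank A r ×
    (∀ (s : Fin r → Fin (suc r)) → Injective _≡_ _≡_ s → HasRank (λ i → A (s i)) r)

  -- The objects of the paper;  α represents P = [α_0 : … : α_n]

  Amat : ∀ {n r} → (Fin (suc n) → Carrier) → ℕ → (Fin (suc r) → ℕ) →
         Fin (suc r) → Fin (suc n) → Carrier
  Amat α d m i j = pow ring (α j) (d ^ m i)

  -- m ∈ M_P  (0 ≤ m_0 is automatic in ℕ)
  InM : ∀ {n r} → (Fin (suc n) → Carrier) → ℕ → (Fin (suc r) → ℕ) → Set (c ⊔ ℓ)
  InM α d m = (∀ i j → i Fin.< j → m i ℕ.< m j) × SuperRank (Amat α d m)

  u : ∀ {n r} → (Fin (suc n) → Carrier) → ℕ →
      Permutation′ (suc r) → (Fin (suc r) → Fin (suc n)) → (Fin (suc r) → ℕ) → Carrier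
  u α d σ p m = prodF ring (λ i → pow ring (α (p i)) (d ^ m (σ ⟨$⟩ʳ i)))

StrictInc : ∀ {r n} → (Fin (suc r) → Fin (suc n)) → Set
StrictInc p = ∀ i j → i Fin.< j → p i Fin.< p j

-- A partition of S_k, given by its equivalence relation "same block"
-- (respecting equality of permutations as maps).
record Partition (k : ℕ) : Set₁ where
  field
    _~_     : Rel (Permutation′ k) 0ℓ
    isEquiv : IsEquivalence _~_
    resp    : ∀ σ σ' τ → (∀ i → σ ⟨$⟩ʳ i ≡ σ' ⟨$⟩ʳ i) → σ ~ τ → σ' ~ τ

-- The partition is a subpartition of I^t_• : every block (the block of τ)
-- lies in some T^t_j = {σ : σ(j) = t}.
SubpartitionOf : ∀ {r} → Partition (suc r) → Fin (suc r) → Set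
SubpartitionOf I t =
  ∀ τ → ∃ λ j → ∀ σ → σ ~ τ → σ ⟨$⟩ʳ j ≡ t
  where open Partition I

Exceptional : ∀ {r} → Partition (suc r) → Set
Exceptional I = ∃ λ t → SubpartitionOf I t

module _ {c ℓ : Level} (K : ACField0 c ℓ) where
  open ACField0 K

  -- F(m) = F(m'): for every p ∈ P_{r,n} and every block T of I_p
  -- (the block of τ), the points [u_{σ,p}(m)]_{σ∈T} and [u_{σ,p}(m')]_{σ∈T}
  -- of projective space coincide, i.e. the vectors are proportional by
  -- a nonzero scalar.
  FEq : ∀ {n r} → (Fin (suc n) → Carrier) → ℕ →
        ((Fin (suc r) → Fin (suc n)) → Partition (suc r)) →
        (Fin (suc r) → ℕ) → (Fin (suc r) → ℕ) → Set (c ⊔ ℓ)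
  FEq α d I m m' =
    ∀ p → StrictInc p → ∀ τ →
      ∃ λ (lam : Carrier) → ¬ (lam ≈ 0#) ×
        (∀ σ → Partition._~_ (I p) σ τ → u K α d σ p m' ≈ lam * u K α d σ p m)

module Submission where

-- Fix p and a block of I_p containing σ and τ.  Since F(m) = F(m') the vectors
-- (u_{ρ,p}(m'))_ρ and (u_{ρ,p}(m))_ρ are proportional on the block, hence
-- u_{σ,p}(m') u_{τ,p}(m) = u_{τ,p}(m') u_{σ,p}(m).  Both sides are monomials
-- ∏_i α_{p(i)}^{A_i} with the same total degree, and as R(P) = {0} and p is
-- injective, the two exponent vectors coincide:
--   d^{m'(σ i)} + d^{m(τ i)} = d^{m'(τ i)} + d^{m(σ i)}   for every i.
-- At i = τ⁻¹(t) uniqueness of base-d expansions with two digits forces either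
-- m'(σ i) = m'(t), i.e. σ(τ⁻¹ t) = t, or m(t) = m'(t).  So when m_t ≠ m'_t the
-- whole block of τ lies in T^t_{τ⁻¹(t)}.

open import Defs
open import Data.Nat as ℕ using (ℕ; zero; suc; _^_; _≤_)
import Data.Nat.Properties as ℕP
open import Data.Integer as ℤ using (ℤ; +_; _⊖_)
import Data.Integer.Properties as ℤP
open import Data.Fin as Fin using (Fin; zero; suc)
import Data.Fin.Properties as FinP
open import Data.Fin.Permutation using (Permutation′; _⟨$⟩ʳ_; _⟨$⟩ˡ_; inverseʳ)
open import Data.Bool using (if_then_else_)
open import Data.Product using (∃; _×_; _,_)
open import Data.Sum using (_⊎_; inj₁; inj₂)
open import Data.Empty using (⊥-elim)
open import Function.Definitions using (Injective)
open import Relation.Binary.Core using (Rel)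
open import Relation.Binary.Definitions using (Irreflexive; Trichotomous; tri<; tri≈; tri>)
open import Relation.Binary.Structures using (IsEquivalence)
open import Relation.Binary.PropositionalEquality as ≡ using (_≡_; _≢_; refl)
open import Relation.Nullary using (¬_; yes; no; does)
open import Relation.Nullary.Decidable using (dec-true; dec-false)
open import Algebra.Bundles using (CommutativeMonoid; CommutativeRing)
import Algebra.Properties.CommutativeMonoid.Sum as Sums
import Algebra.Properties.CommutativeSemigroup as CSemigroupProps

strictlyIncreasing⇒injective :
  ∀ {a b ℓ₁ ℓ₂} {A : Set a} {B : Set b} {_<₁_ : Rel A ℓ₁} {_<₂_ : Rel B ℓ₂} →
  Trichotomous _≡_ _<₁_ → Irreflexive _≡_ _<₂_ →
  (f : A → B) → (∀ x y → x <₁ y → f x <₂ f y) → Injective _≡_ _≡_ f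
strictlyIncreasing⇒injective compare irrefl f mono {x} {y} fx≡fy with compare x y
... | tri< x<y _ _ = ⊥-elim (irrefl fx≡fy (mono x y x<y))
... | tri≈ _ x≡y _ = x≡y
... | tri> _ _ y<x = ⊥-elim (irrefl (≡.sym fx≡fy) (mono y x y<x))

-- Every d ≥ 2 has unique "two-digit" expansions: d^a + d^b determines {a, b}.
module PowersOfBase (d : ℕ) (1<d : 1 ℕ.< d) where
  open ℕP.≤-Reasoning

  instance
    d-nonZero : ℕ.NonZero d
    d-nonZero = ℕ.>-nonZero (ℕP.<-trans (ℕ.s≤s ℕ.z≤n) 1<d)

  ^-injective : Injective _≡_ _≡_ (d ^_)
  ^-injective = strictlyIncreasing⇒injective ℕP.<-cmp ℕP.<-irrefl (d ^_)
                  (λ _ _ → ℕP.^-monoʳ-< d 1<d)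

  two-powers-below : ∀ {a b c} → b ≤ a → a ℕ.< c → d ^ a ℕ.+ d ^ b ≤ d ^ c
  two-powers-below {a} {b} {c} b≤a a<c = begin
    d ^ a ℕ.+ d ^ b   ≤⟨ ℕP.+-monoʳ-≤ (d ^ a) (ℕP.^-monoʳ-≤ d b≤a) ⟩
    d ^ a ℕ.+ d ^ a   ≡⟨ ≡.cong (d ^ a ℕ.+_) (≡.sym (ℕP.+-identityʳ (d ^ a))) ⟩
    2 ℕ.* d ^ a       ≤⟨ ℕP.*-monoˡ-≤ (d ^ a) 1<d ⟩
    d ^ suc a         ≤⟨ ℕP.^-monoʳ-≤ d a<c ⟩
    d ^ c             ∎

  sorted-sum-unique : ∀ {a b c e} → b ≤ a → e ≤ c →
    d ^ a ℕ.+ d ^ b ≡ d ^ c ℕ.+ d ^ e → a ≡ c × b ≡ e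
  sorted-sum-unique {a} {b} {c} {e} b≤a e≤c eq with ℕP.<-cmp a c
  ... | tri< a<c _ _ = ⊥-elim (ℕP.<-irrefl eq
          (ℕP.≤-<-trans (two-powers-below b≤a a<c) (ℕP.m<m+n (d ^ c) (ℕP.m^n>0 d e))))
  ... | tri> _ _ c<a = ⊥-elim (ℕP.<-irrefl (≡.sym eq)
          (ℕP.≤-<-trans (two-powers-below e≤c c<a) (ℕP.m<m+n (d ^ a) (ℕP.m^n>0 d b))))
  ... | tri≈ _ refl _ = refl , ^-injective (ℕP.+-cancelˡ-≡ (d ^ a) _ _ eq)

  two-powers-sum-unique : ∀ a b c e → d ^ a ℕ.+ d ^ b ≡ d ^ c ℕ.+ d ^ e →
    (a ≡ c × b ≡ e) ⊎ (a ≡ e × b ≡ c)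
  two-powers-sum-unique a b c e eq with ℕP.≤-total b a | ℕP.≤-total e c
  ... | inj₁ b≤a | inj₁ e≤c = inj₁ (sorted-sum-unique b≤a e≤c eq)
  ... | inj₁ b≤a | inj₂ c≤e =
    let a≡e , b≡c = sorted-sum-unique b≤a c≤e (≡.trans eq (ℕP.+-comm (d ^ c) _))
    in inj₂ (a≡e , b≡c)
  ... | inj₂ a≤b | inj₁ e≤c =
    let b≡c , a≡e = sorted-sum-unique a≤b e≤c (≡.trans (ℕP.+-comm (d ^ b) _) eq)
    in inj₂ (a≡e , b≡c)
  ... | inj₂ a≤b | inj₂ c≤e =
    let b≡e , a≡c = sorted-sum-unique a≤b c≤e
                      (≡.trans (ℕP.+-comm (d ^ b) _) (≡.trans eq (ℕP.+-comm (d ^ c) _)))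
    in inj₁ (a≡c , b≡e)

module ℕSum = Sums ℕP.+-0-commutativeMonoid
module ℤSum = Sums ℤP.+-0-commutativeMonoid

⊖-+ : ∀ a b c e → (a ⊖ b) ℤ.+ (c ⊖ e) ≡ (a ℕ.+ c) ⊖ (b ℕ.+ e)
⊖-+ a b c e = begin
  (a ⊖ b) ℤ.+ (c ⊖ e)              ≡⟨ ≡.cong₂ ℤ._+_ (≡.sym (ℤP.m-n≡m⊖n a b)) (≡.sym (ℤP.m-n≡m⊖n c e)) ⟩
  (+ a ℤ.- + b) ℤ.+ (+ c ℤ.- + e)  ≡⟨ interchange (+ a) (+ b) (+ c) (+ e) ⟩
  (+ a ℤ.+ + c) ℤ.- (+ b ℤ.+ + e)  ≡⟨ ℤP.m-n≡m⊖n (a ℕ.+ c) (b ℕ.+ e) ⟩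
  (a ℕ.+ c) ⊖ (b ℕ.+ e)            ∎
  where
  open ≡.≡-Reasoning
  open import Data.Integer.Tactic.RingSolver using (solve-∀)
  interchange : ∀ x y z w → (x ℤ.- y) ℤ.+ (z ℤ.- w) ≡ (x ℤ.+ z) ℤ.- (y ℤ.+ w)
  interchange = solve-∀

sum-⊖ : ∀ {k} (a b : Fin k → ℕ) → ℤSum.sum (λ i → a i ⊖ b i) ≡ ℕSum.sum a ⊖ ℕSum.sum b
sum-⊖ {zero}  a b = refl
sum-⊖ {suc k} a b =
  ≡.trans (≡.cong (λ s → (a zero ⊖ b zero) ℤ.+ s) (sum-⊖ (λ i → a (suc i)) (λ i → b (suc i))))
          (⊖-+ (a zero) (b zero) _ _)

⊖≡0⇒≡ : ∀ a b → a ⊖ b ≡ + 0 → a ≡ b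
⊖≡0⇒≡ a b a⊖b≡0 = ℤP.+-injective (ℤP.i-j≡0⇒i≡j (+ a) (+ b) (≡.trans (ℤP.m-n≡m⊖n a b) a⊖b≡0))

sum-permuted-pair : ∀ {k} (a b : Fin k → ℕ) (σ τ : Permutation′ k) →
  ℕSum.sum (λ i → a (σ ⟨$⟩ʳ i) ℕ.+ b (τ ⟨$⟩ʳ i)) ≡ ℕSum.sum (λ i → a (τ ⟨$⟩ʳ i) ℕ.+ b (σ ⟨$⟩ʳ i))
sum-permuted-pair {k} a b σ τ = begin
  ℕSum.sum (λ i → a (σ ⟨$⟩ʳ i) ℕ.+ b (τ ⟨$⟩ʳ i))                 ≡⟨ ℕSum.∑-distrib-+ {k} (λ i → a (σ ⟨$⟩ʳ i)) (λ i → b (τ ⟨$⟩ʳ i)) ⟩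
  ℕSum.sum (λ i → a (σ ⟨$⟩ʳ i)) ℕ.+ ℕSum.sum (λ i → b (τ ⟨$⟩ʳ i)) ≡⟨ ≡.cong₂ ℕ._+_ (permute a σ) (permute b τ) ⟩
  ℕSum.sum a ℕ.+ ℕSum.sum b                                         ≡⟨ ≡.sym (≡.cong₂ ℕ._+_ (permute a τ) (permute b σ)) ⟩
  ℕSum.sum (λ i → a (τ ⟨$⟩ʳ i)) ℕ.+ ℕSum.sum (λ i → b (σ ⟨$⟩ʳ i)) ≡⟨ ≡.sym (ℕSum.∑-distrib-+ {k} (λ i → a (τ ⟨$⟩ʳ i)) (λ i → b (σ ⟨$⟩ʳ i))) ⟩
  ℕSum.sum (λ i → a (τ ⟨$⟩ʳ i) ℕ.+ b (σ ⟨$⟩ʳ i))                 ∎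
  where
  open ≡.≡-Reasoning
  permute : ∀ {k} (f : Fin k → ℕ) (π : Permutation′ k) → ℕSum.sum (λ i → f (π ⟨$⟩ʳ i)) ≡ ℕSum.sum f
  permute f π = ≡.sym (ℕSum.sum-permute f π)

-- This turns a relation among the
-- α_{p(i)} into a relation among all of α_0, …, α_n.
module Pushforward {a ℓ} (M : CommutativeMonoid a ℓ) where
  open CommutativeMonoid M hiding (refl)
  open Sums M using (sum; sum-remove; sum-cong-≋; sum-replicate-zero; sum-cong-≗; ∑-comm)
  open import Relation.Binary.Reasoning.Setoid setoid

  when : ∀ {k l} (p : Fin k → Fin l) → Fin k → Fin l → Carrier → Carrier
  when p i j x = if does (p i Fin.≟ j) then x else ε

  when-≡ : ∀ {k l} (p : Fin k → Fin l) {i j x} → p i ≡ j → when p i j x ≡ x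
  when-≡ p {i} {j} eq rewrite dec-true (p i Fin.≟ j) eq = refl

  when-≢ : ∀ {k l} (p : Fin k → Fin l) {i j x} → p i ≢ j → when p i j x ≡ ε
  when-≢ p {i} {j} ne rewrite dec-false (p i Fin.≟ j) ne = refl

  sum-single : ∀ {n} (f : Fin n → Carrier) (j₀ : Fin n) →
               (∀ j → j ≢ j₀ → f j ≈ ε) → sum f ≈ f j₀
  sum-single {suc n} f j₀ vanish = begin
    sum f                                         ≈⟨ sum-remove {i = j₀} f ⟩
    f j₀ ∙ sum (λ k → f (Fin.punchIn j₀ k))       ≈⟨ ∙-congˡ (sum-cong-≋ {n} (λ k → vanish _ (FinP.punchInᵢ≢i j₀ k))) ⟩
    f j₀ ∙ sum {n} (λ _ → ε)                      ≈⟨ ∙-congˡ (sum-replicate-zero n) ⟩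
    f j₀ ∙ ε                                      ≈⟨ identityʳ (f j₀) ⟩
    f j₀                                          ∎

  push : ∀ {k l} (p : Fin k → Fin l) → (Fin k → Fin l → Carrier) → Fin l → Carrier
  push p f j = sum (λ i → when p i j (f i j))

  push-total : ∀ {k l} (p : Fin k → Fin l) (f : Fin k → Fin l → Carrier) →
               sum (push p f) ≈ sum (λ i → f i (p i))
  push-total {k} p f = begin
    sum (λ j → sum (λ i → when p i j (f i j)))   ≈⟨ ∑-comm (λ j i → when p i j (f i j)) ⟩
    sum (λ i → sum (λ j → when p i j (f i j)))   ≈⟨ sum-cong-≋ (λ i → sum-single _ (p i)
                                                       (λ j j≢pi → reflexive (when-≢ p (≡.≢-sym j≢pi)))) ⟩
    sum (λ i → when p i (p i) (f i (p i)))       ≡⟨ sum-cong-≗ {k} (λ i → when-≡ p {i} refl) ⟩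
    sum (λ i → f i (p i))                        ∎

  push-hit : ∀ {k l} (p : Fin k → Fin l) → Injective _≡_ _≡_ p →
             (f : Fin k → Fin l → Carrier) (i : Fin k) → push p f (p i) ≈ f i (p i)
  push-hit p p-inj f i = trans
    (sum-single _ i (λ i′ i′≢i → reflexive (when-≢ p (λ eq → i′≢i (p-inj eq)))))
    (reflexive (when-≡ p {i} refl))

  push-miss : ∀ {k l} (p : Fin k → Fin l) (f : Fin k → Fin l → Carrier) (j : Fin l) →
              (∀ i → p i ≢ j) → push p f j ≈ ε
  push-miss {k} p f j miss =
    trans (sum-cong-≋ (λ i → reflexive (when-≢ p (miss i)))) (sum-replicate-zero k)

module FieldArithmetic {c ℓ} (K : ACField0 c ℓ) where
  open ACField0 K
  open CommutativeRing ring using (setoid; sym; trans; *-comm; *-assoc; *-cong; *-congˡ; *-congʳ;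
    *-identityˡ; *-identityʳ; zeroˡ; *-commutativeMonoid; *-commutativeSemigroup)
  open CSemigroupProps *-commutativeSemigroup using (interchange)
  open import Relation.Binary.Reasoning.Setoid setoid
  module Prod = Sums *-commutativeMonoid

  prodF≡∏ : ∀ {k} (f : Fin k → Carrier) → prodF ring f ≡ Prod.sum f
  prodF≡∏ {zero}  f = refl
  prodF≡∏ {suc k} f = ≡.cong (f zero *_) (prodF≡∏ (λ i → f (suc i)))

  sumℤ≡∑ : ∀ {k} (e : Fin k → ℤ) → sumℤ K e ≡ ℤSum.sum e
  sumℤ≡∑ {zero}  e = refl
  sumℤ≡∑ {suc k} e = ≡.cong (λ s → e zero ℤ.+ s) (sumℤ≡∑ (λ i → e (suc i)))

  nonzero-* : ∀ {x y} → ¬ x ≈ 0# → ¬ y ≈ 0# → ¬ x * y ≈ 0#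
  nonzero-* {x} {y} x≉0 y≉0 xy≈0 = 0≉1 (begin
    0#                        ≈⟨ sym (zeroˡ _) ⟩
    0# * (x ⁻¹ * y ⁻¹)        ≈⟨ *-congʳ (sym xy≈0) ⟩
    (x * y) * (x ⁻¹ * y ⁻¹)   ≈⟨ interchange x y (x ⁻¹) (y ⁻¹) ⟩
    (x * x ⁻¹) * (y * y ⁻¹)   ≈⟨ *-cong (inverse x x≉0) (inverse y y≉0) ⟩
    1# * 1#                   ≈⟨ *-identityˡ 1# ⟩
    1#                        ∎)

  1≉0 : ¬ 1# ≈ 0#
  1≉0 1≈0 = 0≉1 (sym 1≈0)

  nonzero-pow : ∀ {x} → ¬ x ≈ 0# → ∀ k → ¬ pow ring x k ≈ 0#
  nonzero-pow x≉0 zero    = 1≉0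
  nonzero-pow x≉0 (suc k) = nonzero-* x≉0 (nonzero-pow x≉0 k)

  nonzero-∏ : ∀ {k} (f : Fin k → Carrier) → (∀ i → ¬ f i ≈ 0#) → ¬ Prod.sum f ≈ 0#
  nonzero-∏ {zero}  f f≉0 = 1≉0
  nonzero-∏ {suc k} f f≉0 = nonzero-* (f≉0 zero) (nonzero-∏ (λ i → f (suc i)) (λ i → f≉0 (suc i)))

  cancel : ∀ {z q} → ¬ q ≈ 0# → z * q ≈ q → z ≈ 1#
  cancel {z} {q} q≉0 zq≈q = begin
    z                ≈⟨ sym (*-identityʳ z) ⟩
    z * 1#           ≈⟨ *-congˡ (sym (inverse q q≉0)) ⟩
    z * (q * q ⁻¹)   ≈⟨ sym (*-assoc z q (q ⁻¹)) ⟩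
    (z * q) * q ⁻¹   ≈⟨ *-congʳ zq≈q ⟩
    q * q ⁻¹         ≈⟨ inverse q q≉0 ⟩
    1#               ∎

  pow-+ : ∀ x a b → pow ring x (a ℕ.+ b) ≈ pow ring x a * pow ring x b
  pow-+ x zero    b = sym (*-identityˡ _)
  pow-+ x (suc a) b = trans (*-congˡ (pow-+ x a b)) (sym (*-assoc x _ _))

  pow-inverse : ∀ {x} → ¬ x ≈ 0# → ∀ k → pow ring (x ⁻¹) k * pow ring x k ≈ 1#
  pow-inverse x≉0 zero = *-identityˡ 1#
  pow-inverse {x} x≉0 (suc k) = begin
    (x ⁻¹ * pow ring (x ⁻¹) k) * (x * pow ring x k)   ≈⟨ interchange _ _ _ _ ⟩
    (x ⁻¹ * x) * (pow ring (x ⁻¹) k * pow ring x k)   ≈⟨ *-cong (trans (*-comm _ _) (inverse x x≉0)) (pow-inverse x≉0 k) ⟩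
    1# * 1#                                           ≈⟨ *-identityˡ 1# ⟩
    1#                                                ∎

  zpow-⊖ : ∀ {x} → ¬ x ≈ 0# → ∀ a b → zpow K x (a ⊖ b) * pow ring x b ≈ pow ring x a
  zpow-⊖ x≉0 zero    zero    = *-identityˡ 1#
  zpow-⊖ x≉0 (suc a) zero    = *-identityʳ _
  zpow-⊖ x≉0 zero    (suc b) = pow-inverse x≉0 (suc b)
  zpow-⊖ {x} x≉0 (suc a) (suc b) rewrite ℤP.[1+m]⊖[1+n]≡m⊖n a b = begin
    zpow K x (a ⊖ b) * (x * pow ring x b)   ≈⟨ sym (*-assoc _ x _) ⟩
    (zpow K x (a ⊖ b) * x) * pow ring x b   ≈⟨ *-congʳ (*-comm _ x) ⟩
    (x * zpow K x (a ⊖ b)) * pow ring x b   ≈⟨ *-assoc x _ _ ⟩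
    x * (zpow K x (a ⊖ b) * pow ring x b)   ≈⟨ *-congˡ (zpow-⊖ x≉0 a b) ⟩
    x * pow ring x a                        ∎

module MultiplicativeIndependence {c ℓ} (K : ACField0 c ℓ) {n : ℕ}
    (α : Fin (suc n) → ACField0.Carrier K)
    (α≉0 : ∀ j → ¬ ACField0._≈_ K (α j) (ACField0.0# K))
    (trivial : TrivialRelations K α) where
  open ACField0 K
  open CommutativeRing ring using (setoid; sym; *-commutativeMonoid)
  open import Relation.Binary.Reasoning.Setoid setoid
  open FieldArithmetic K
  module ℤPush = Pushforward ℤP.+-0-commutativeMonoid
  module KPush = Pushforward *-commutativeMonoid

  -- A subfamily (α_{p(i)})_i along an injective p still has only the trivial
  -- relation: push the exponents g forward to an exponent vector e on all α_j.
  relations-along-injection : ∀ {k} (p : Fin k → Fin (suc n)) → Injective _≡_ _≡_ p →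
    (g : Fin k → ℤ) → ℤSum.sum g ≡ + 0 →
    Prod.sum (λ i → zpow K (α (p i)) (g i)) ≈ 1# → ∀ i → g i ≡ + 0
  relations-along-injection {k} p p-inj g Σg≡0 ∏≈1 i =
    ≡.trans (≡.sym (ℤPush.push-hit p p-inj (λ i _ → g i) i)) (trivial e Σe≡0 ∏e≈1 (p i))
    where
    e : Fin (suc n) → ℤ
    e = ℤPush.push p (λ i _ → g i)

    Σe≡0 : sumℤ K e ≡ + 0
    Σe≡0 = ≡.trans (sumℤ≡∑ e) (≡.trans (ℤPush.push-total p (λ i _ → g i)) Σg≡0)

    h : Fin k → Fin (suc n) → Carrier
    h i j = zpow K (α j) (g i)

    factor : ∀ j → zpow K (α j) (e j) ≈ KPush.push p h j
    factor j with FinP.any? (λ i → p i Fin.≟ j)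
    ... | yes (i , refl) = begin
      zpow K (α (p i)) (e (p i))   ≡⟨ ≡.cong (zpow K (α (p i))) (ℤPush.push-hit p p-inj _ i) ⟩
      zpow K (α (p i)) (g i)       ≈⟨ sym (KPush.push-hit p p-inj h i) ⟩
      KPush.push p h (p i)         ∎
    ... | no ∉image = begin
      zpow K (α j) (e j)           ≡⟨ ≡.cong (zpow K (α j)) (ℤPush.push-miss p _ j miss) ⟩
      1#                           ≈⟨ sym (KPush.push-miss p h j miss) ⟩
      KPush.push p h j             ∎
      where
      miss : ∀ i → p i ≢ j
      miss i pi≡j = ∉image (i , pi≡j)

    ∏e≈1 : prodF ring (λ j → zpow K (α j) (e j)) ≈ 1#
    ∏e≈1 = begin
      prodF ring (λ j → zpow K (α j) (e j))   ≡⟨ prodF≡∏ (λ j → zpow K (α j) (e j)) ⟩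
      Prod.sum (λ j → zpow K (α j) (e j))     ≈⟨ Prod.sum-cong-≋ factor ⟩
      Prod.sum (KPush.push p h)               ≈⟨ KPush.push-total p h ⟩
      Prod.sum (λ i → zpow K (α (p i)) (g i)) ≈⟨ ∏≈1 ⟩
      1#                                      ∎

  monomial-exponents-unique : ∀ {k} (p : Fin k → Fin (suc n)) → Injective _≡_ _≡_ p →
    (A B : Fin k → ℕ) → ℕSum.sum A ≡ ℕSum.sum B →
    Prod.sum (λ i → pow ring (α (p i)) (A i)) ≈ Prod.sum (λ i → pow ring (α (p i)) (B i)) →
    ∀ i → A i ≡ B i
  monomial-exponents-unique p p-inj A B ΣA≡ΣB ∏A≈∏B i =
    ⊖≡0⇒≡ (A i) (B i) (relations-along-injection p p-inj g Σg≡0 ∏g≈1 i)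
    where
    g : Fin _ → ℤ
    g i = A i ⊖ B i

    α^ : Fin _ → ℕ → Carrier
    α^ i = pow ring (α (p i))

    Σg≡0 : ℤSum.sum g ≡ + 0
    Σg≡0 = ≡.trans (sum-⊖ A B) (≡.trans (≡.cong (_⊖ ℕSum.sum B) ΣA≡ΣB) (ℤP.n⊖n≡0 (ℕSum.sum B)))

    ∏g≈1 : Prod.sum (λ i → zpow K (α (p i)) (g i)) ≈ 1#
    ∏g≈1 = cancel (nonzero-∏ _ (λ i → nonzero-pow (α≉0 (p i)) (B i))) (begin
      Prod.sum (λ i → zpow K (α (p i)) (g i)) * Prod.sum (λ i → α^ i (B i))
        ≈⟨ sym (Prod.∑-distrib-+ (λ i → zpow K (α (p i)) (g i)) (λ i → α^ i (B i))) ⟩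
      Prod.sum (λ i → zpow K (α (p i)) (g i) * α^ i (B i))
        ≈⟨ Prod.sum-cong-≋ (λ i → zpow-⊖ (α≉0 (p i)) (A i) (B i)) ⟩
      Prod.sum (λ i → α^ i (A i))
        ≈⟨ ∏A≈∏B ⟩
      Prod.sum (λ i → α^ i (B i)) ∎)

module Exchange {c ℓ} (K : ACField0 c ℓ) {n r : ℕ} (d : ℕ)
    (α : Fin (suc n) → ACField0.Carrier K)
    (α≉0 : ∀ j → ¬ ACField0._≈_ K (α j) (ACField0.0# K))
    (trivial : TrivialRelations K α)
    (I : (Fin (suc r) → Fin (suc n)) → Partition (suc r))
    (m m' : Fin (suc r) → ℕ) (F≡ : FEq K α d I m m') where
  open ACField0 K
  open CommutativeRing ring using (setoid; sym; trans; *-comm; *-assoc; *-congˡ; *-congʳ)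
  open import Relation.Binary.Reasoning.Setoid setoid
  open FieldArithmetic K
  open MultiplicativeIndependence K α α≉0 trivial

  -- exponent of α_{p(i)} in u_{σ,p}(m') · u_{τ,p}(m)
  crossExponent : Permutation′ (suc r) → Permutation′ (suc r) → Fin (suc r) → ℕ
  crossExponent σ τ i = d ^ m' (σ ⟨$⟩ʳ i) ℕ.+ d ^ m (τ ⟨$⟩ʳ i)

  cross-monomial : ∀ (p : Fin (suc r) → Fin (suc n)) σ τ →
    u K α d σ p m' * u K α d τ p m ≈ Prod.sum (λ i → pow ring (α (p i)) (crossExponent σ τ i))
  cross-monomial p σ τ = begin
    u K α d σ p m' * u K α d τ p m
      ≡⟨ ≡.cong₂ _*_ (prodF≡∏ (λ i → α^ i (d ^ m' (σ ⟨$⟩ʳ i)))) (prodF≡∏ (λ i → α^ i (d ^ m (τ ⟨$⟩ʳ i)))) ⟩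
    Prod.sum (λ i → α^ i (d ^ m' (σ ⟨$⟩ʳ i))) * Prod.sum (λ i → α^ i (d ^ m (τ ⟨$⟩ʳ i)))
      ≈⟨ sym (Prod.∑-distrib-+ (λ i → α^ i (d ^ m' (σ ⟨$⟩ʳ i))) (λ i → α^ i (d ^ m (τ ⟨$⟩ʳ i)))) ⟩
    Prod.sum (λ i → α^ i (d ^ m' (σ ⟨$⟩ʳ i)) * α^ i (d ^ m (τ ⟨$⟩ʳ i)))
      ≈⟨ Prod.sum-cong-≋ (λ i → sym (pow-+ (α (p i)) (d ^ m' (σ ⟨$⟩ʳ i)) (d ^ m (τ ⟨$⟩ʳ i)))) ⟩
    Prod.sum (λ i → α^ i (crossExponent σ τ i)) ∎
    where
    α^ : Fin (suc r) → ℕ → Carrier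
    α^ i = pow ring (α (p i))

  cross-ratio : ∀ p → StrictInc p → ∀ {σ τ} → Partition._~_ (I p) σ τ →
    u K α d σ p m' * u K α d τ p m ≈ u K α d τ p m' * u K α d σ p m
  cross-ratio p p-inc {σ} {τ} σ~τ with F≡ p p-inc τ
  ... | λ′ , _ , proportional = begin
    uσ m' * uτ m            ≈⟨ *-congʳ (proportional σ σ~τ) ⟩
    (λ′ * uσ m) * uτ m      ≈⟨ *-congʳ (*-comm λ′ (uσ m)) ⟩
    (uσ m * λ′) * uτ m      ≈⟨ *-assoc (uσ m) λ′ (uτ m) ⟩
    uσ m * (λ′ * uτ m)      ≈⟨ *-congˡ (sym (proportional τ τ~τ)) ⟩
    uσ m * uτ m'            ≈⟨ *-comm (uσ m) (uτ m') ⟩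
    uτ m' * uσ m            ∎
    where
    uσ uτ : (Fin (suc r) → ℕ) → Carrier
    uσ = u K α d σ p
    uτ = u K α d τ p
    τ~τ : Partition._~_ (I p) τ τ
    τ~τ = IsEquivalence.refl (Partition.isEquiv (I p))

  exchange : ∀ p → StrictInc p → ∀ {σ τ} → Partition._~_ (I p) σ τ →
    ∀ i → crossExponent σ τ i ≡ crossExponent τ σ i
  exchange p p-inc {σ} {τ} σ~τ = monomial-exponents-unique p p-injective
    (crossExponent σ τ) (crossExponent τ σ)
    (sum-permuted-pair (λ j → d ^ m' j) (λ j → d ^ m j) σ τ)
    (trans (sym (cross-monomial p σ τ)) (trans (cross-ratio p p-inc σ~τ) (cross-monomial p τ σ)))
    where
    p-injective : Injective _≡_ _≡_ p
    p-injective = strictlyIncreasing⇒injective FinP.<-cmp FinP.<-irrefl p p-inc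

  block-in-T : 2 ≤ d → (∀ i j → i Fin.< j → m' i ℕ.< m' j) →
    ∀ t → m t ≢ m' t → ∀ p → StrictInc p → ∀ {σ τ} → Partition._~_ (I p) σ τ →
    σ ⟨$⟩ʳ (τ ⟨$⟩ˡ t) ≡ t
  block-in-T 2≤d m'-inc t mt≢m't p p-inc {σ} {τ} σ~τ
    with PowersOfBase.two-powers-sum-unique d 2≤d (m' (σ ⟨$⟩ʳ i₀)) (m t) (m' t) (m (σ ⟨$⟩ʳ i₀)) exchange-at-i₀
    where
    i₀ : Fin (suc r)
    i₀ = τ ⟨$⟩ˡ t
    exchange-at-i₀ : d ^ m' (σ ⟨$⟩ʳ i₀) ℕ.+ d ^ m t ≡ d ^ m' t ℕ.+ d ^ m (σ ⟨$⟩ʳ i₀)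
    exchange-at-i₀ = ≡.subst (λ x → d ^ m' (σ ⟨$⟩ʳ i₀) ℕ.+ d ^ m x ≡ d ^ m' x ℕ.+ d ^ m (σ ⟨$⟩ʳ i₀))
                       (inverseʳ τ) (exchange p p-inc σ~τ i₀)
  ... | inj₁ (m'σi₀≡m't , _) = strictlyIncreasing⇒injective FinP.<-cmp ℕP.<-irrefl m' m'-inc m'σi₀≡m't
  ... | inj₂ (_ , mt≡m't)    = ⊥-elim (mt≢m't mt≡m't)

lemma4p11 : ∀ {c ℓ} (K : ACField0 c ℓ) (n d r : ℕ) →
    1 ≤ n → 2 ≤ d → 1 ≤ r → r ≤ n →
    (α : Fin (suc n) → ACField0.Carrier K) →
    (∀ i → ¬ ACField0._≈_ K (α i) (ACField0.0# K)) →
    TrivialRelations K α →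
    (I : (Fin (suc r) → Fin (suc n)) → Partition (suc r)) →
    ((∃ λ p → StrictInc p × ¬ Exceptional (I p)) →
      ∀ m m' → InM K α d m → InM K α d m' → FEq K α d I m m' → ∀ i → m i ≡ m' i)
    ×
    (∀ m m' → InM K α d m → InM K α d m' → FEq K α d I m m' →
      ∀ t → ¬ (m t ≡ m' t) → ∀ p → StrictInc p → SubpartitionOf (I p) t)
lemma4p11 K n d r _ 2≤d _ _ α α≉0 trivial I = injective , refines
  where
  refines : ∀ m m' → InM K α d m → InM K α d m' → FEq K α d I m m' →
    ∀ t → ¬ (m t ≡ m' t) → ∀ p → StrictInc p → SubpartitionOf (I p) t
  refines m m' _ (m'-inc , _) F≡ t mt≢m't p p-inc τ =
    τ ⟨$⟩ˡ t , λ σ σ~τ → Exchange.block-in-T K d α α≉0 trivial I m m' F≡ 2≤d m'-inc t mt≢m't p p-inc σ~τ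

  -- a coordinate where m and m' differ would make I_p exceptional
  injective : (∃ λ p → StrictInc p × ¬ Exceptional (I p)) →
    ∀ m m' → InM K α d m → InM K α d m' → FEq K α d I m m' → ∀ i → m i ≡ m' i
  injective (p , p-inc , ¬exceptional) m m' m∈M m'∈M F≡ t with m t ℕP.≟ m' t
  ... | yes mt≡m't = mt≡m't
  ... | no mt≢m't = ⊥-elim (¬exceptional (t , refines m m' m∈M m'∈M F≡ t mt≢m't p p-inc))
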